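{- Let $E$ be a field of characteristic $0$ and let $\mathbb{M}$ be the abelian category defined in the context. Let $U^*$ and $W^*$ be Lefschetz modules in $\mathbb{M}$ with centers $m/2$ and $n/2$ respectively ($m,n$ integers). Then: (1) if $m>n$, then $\mathrm{Hom}_{\mathbb{M}}(W,U)=0$; (2) if $m=n+1$, then $\mathrm{Ext}^1_{\mathbb{M}}(W,U)=0$.
   Context: $\mathbb{M}$ is the abelian category whose objects are graded $E$-vector spaces $V^*=\bigoplus_{i\in\mathbb{Z}}V^i$ with $V^i=0$ for $|i|\gg 0$, equipped with an $E$-linear operator $\mathsf{L}$ of degree $1$, $\mathsf{L}:V^i\to V^{i+1}$; morphisms are degree-preserving $E$-linear maps commuting with $\mathsf{L}$. A Lefschetz module with center $n/2$ (for an integer $n$) is an object $V^*$ of $\mathbb{M}$ such that for every $i\le n/2$ the map $\mathsf{L}^{n-2i}:V^i\to V^{n-i}$ is an isomorphism. -}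

module Defs where

open import Level using (Level; _⊔_) renaming (suc to lsuc)
open import Algebra.Bundles using (CommutativeRing)
open import Algebra.Module.Bundles using (Module)
import Algebra.Module.Morphism.Structures as ModMor
open import Data.Nat as ℕ using (ℕ; zero; suc)
open import Data.Integer as ℤ using (ℤ; +_; ∣_∣)
import Data.Integer.Properties as ℤP
open import Data.Product using (Σ; ∃; _×_; _,_)
open import Function.Definitions using (Injective; Surjective; Bijective)
open import Relation.Nullary using (¬_)
open import Relation.Binary.PropositionalEquality using (_≡_; refl; sym; trans; cong; subst)

module _ {c ℓ : Level} (E : CommutativeRing c ℓ) where
  open CommutativeRing E

  record IsField : Set (c ⊔ ℓ) where
    field
      0≉1     : ¬ (0# ≈ 1#)
      inverse : ∀ x → ¬ (x ≈ 0#) → ∃ λ y → (x * y) ≈ 1#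

  natE : ℕ → Carrier
  natE zero    = 0#
  natE (suc n) = 1# + natE n

  CharZero : Set ℓ
  CharZero = ∀ n → ¬ (natE (suc n) ≈ 0#)

-- The category 𝕄 of bounded graded E-vector spaces with a degree-1
-- operator 𝖫.

module _ {c ℓ : Level} (E : CommutativeRing c ℓ) where

  IsLinear : ∀ {m₁ ℓ₁ m₂ ℓ₂} (A : Module E m₁ ℓ₁) (B : Module E m₂ ℓ₂) →
             (Module.Carrierᴹ A → Module.Carrierᴹ B) → Set (c ⊔ m₁ ⊔ ℓ₁ ⊔ ℓ₂)
  IsLinear A B f =
    ModMor.ModuleMorphisms.IsModuleHomomorphism (Module.rawModule A) (Module.rawModule B) f

  record Obj (m ℓm : Level) : Set (c ⊔ ℓ ⊔ lsuc (m ⊔ ℓm)) where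
    field
      V        : ℤ → Module E m ℓm
      bounded  : ∃ λ N → ∀ i → N ℕ.< ∣ i ∣ →
                 ∀ (x : Module.Carrierᴹ (V i)) → Module._≈ᴹ_ (V i) x (Module.0ᴹ (V i))
      L        : ∀ i → Module.Carrierᴹ (V i) → Module.Carrierᴹ (V (i ℤ.+ + 1))
      L-linear : ∀ i → IsLinear (V i) (V (i ℤ.+ + 1)) (L i)

    Elt : ℤ → Set m
    Elt i = Module.Carrierᴹ (V i)

    Lpow : ∀ k i → Elt i → Elt (i ℤ.+ + k)
    Lpow zero    i x = subst Elt (sym (ℤP.+-identityʳ i)) x
    Lpow (suc k) i x = subst Elt eq (L (i ℤ.+ + k) (Lpow k i x))
      where
        eq : (i ℤ.+ + k) ℤ.+ + 1 ≡ i ℤ.+ + suc k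
        eq = trans (ℤP.+-assoc i (+ k) (+ 1))
                   (cong (λ t → i ℤ.+ + t) (ℕP-+1 k))
          where
            ℕP-+1 : ∀ k → k ℕ.+ 1 ≡ suc k
            ℕP-+1 zero    = refl
            ℕP-+1 (suc k) = cong suc (ℕP-+1 k)

  open Obj

  record Hom {m₁ ℓ₁ m₂ ℓ₂ : Level} (A : Obj m₁ ℓ₁) (B : Obj m₂ ℓ₂)
         : Set (c ⊔ m₁ ⊔ ℓ₁ ⊔ m₂ ⊔ ℓ₂) where
    field
      f        : ∀ i → Elt A i → Elt B i
      f-linear : ∀ i → IsLinear (V A i) (V B i) (f i)
      f-L      : ∀ i (x : Elt A i) →
                 Module._≈ᴹ_ (V B (i ℤ.+ + 1)) (f (i ℤ.+ + 1) (L A i x)) (L B i (f i x))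

  open Hom

  -- Lefschetz module with center n/2: for every i with 2i ≤ n, writing
  -- n - 2i = k, the map 𝖫^k : V^i → V^{i+k} = V^{n-i} is an isomorphism.
  IsLefschetz : ∀ {m ℓm} → Obj m ℓm → ℤ → Set (m ⊔ ℓm)
  IsLefschetz A n =
    ∀ (i : ℤ) (k : ℕ) → (i ℤ.+ i) ℤ.+ + k ≡ n →
      Bijective (Module._≈ᴹ_ (V A i)) (Module._≈ᴹ_ (V A (i ℤ.+ + k))) (Lpow A k i)

  IsZeroHom : ∀ {m₁ ℓ₁ m₂ ℓ₂} {A : Obj m₁ ℓ₁} {B : Obj m₂ ℓ₂} → Hom A B → Set (m₁ ⊔ ℓ₂)
  IsZeroHom {B = B} φ = ∀ i x → Module._≈ᴹ_ (V B i) (f φ i x) (Module.0ᴹ (V B i))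

  HomVanishes : ∀ {m ℓm} → Obj m ℓm → Obj m ℓm → Set (c ⊔ m ⊔ ℓm)
  HomVanishes W U = ∀ (φ : Hom W U) → IsZeroHom φ

  -- 0 → U --ι--> X --π--> W → 0 is a short exact sequence in 𝕄
  -- (kernels, images and cokernels in 𝕄 are computed degreewise)
  record IsShortExact {m ℓm} {U X W : Obj m ℓm} (ι : Hom U X) (π : Hom X W)
         : Set (m ⊔ ℓm) where
    field
      ι-injective  : ∀ i → Injective (Module._≈ᴹ_ (V U i)) (Module._≈ᴹ_ (V X i)) (f ι i)
      π-surjective : ∀ i → Surjective (Module._≈ᴹ_ (V X i)) (Module._≈ᴹ_ (V W i)) (f π i)
      im⊆ker       : ∀ i (u : Elt U i) →
                     Module._≈ᴹ_ (V W i) (f π i (f ι i u)) (Module.0ᴹ (V W i))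
      ker⊆im       : ∀ i (x : Elt X i) →
                     Module._≈ᴹ_ (V W i) (f π i x) (Module.0ᴹ (V W i)) →
                     ∃ λ u → Module._≈ᴹ_ (V X i) (f ι i u) x

  -- Ext¹_𝕄(W,U) = 0 (Yoneda Ext): every short exact sequence
  -- 0 → U → X → W → 0 in 𝕄 splits, i.e. π has a section in 𝕄.
  Ext1Vanishes : ∀ {m ℓm} → Obj m ℓm → Obj m ℓm → Set (c ⊔ ℓ ⊔ lsuc (m ⊔ ℓm))
  Ext1Vanishes {m} {ℓm} W U =
    ∀ (X : Obj m ℓm) (ι : Hom U X) (π : Hom X W) → IsShortExact ι π →
      Σ (Hom W X) λ s → ∀ i (w : Elt W i) → Module._≈ᴹ_ (V W i) (f π i (f s i w)) w

module Submission where

-- Everything rests on the Lefschetz isomorphisms 𝖫ⁿ⁻²ⁱ : V^i ≅ V^(n-i), used degree by degree,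
-- and on induction on the degree from below, objects of 𝕄 being zero in low degrees.
--
-- (1) For 2i ≤ n every x ∈ W^i splits as x = p + 𝖫z with 𝖫ⁿ⁻²ⁱ⁺¹ p = 0: choose z with
-- 𝖫ⁿ⁻²ⁱ⁺² z = 𝖫ⁿ⁻²ⁱ⁺¹ x. By induction φ(𝖫z) = 𝖫φ(z) = 0, while 𝖫ᵐ⁻²ⁱ φ(p) = 𝖫ᵐ⁻ⁿ⁻¹ φ(𝖫ⁿ⁻²ⁱ⁺¹ p) = 0
-- and 𝖫ᵐ⁻²ⁱ is injective on U^i, so φ(p) = 0. Degrees above n/2 are 𝖫-images of lower ones.
--
-- (2) For 0 → U → X → W → 0, let Y ⊆ X be given by Y^i = {y | 𝖫ⁿ⁻²ⁱ⁺¹ y ∈ 𝖫ⁿ⁻²ⁱ⁺² Y^(i-1)} for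
-- 2i ≤ n and Y^i = 𝖫²ⁱ⁻ⁿ Y^(n-i) above. A lift x ∈ X^i of w ∈ W^i can be corrected by an element
-- of U^i so as to lie in Y^i, because for m = n + 1 the map 𝖫ⁿ⁻²ⁱ⁺¹ : U^i → U^(m-i) is a Lefschetz
-- isomorphism; the same isomorphism shows that π is injective on Y^i. So π restricts to an
-- isomorphism Y ≅ W in 𝕄, whose inverse splits the sequence.

open import Defs
open import Level using (Level; _⊔_; Lift; lift)
open import Algebra.Bundles using (CommutativeRing)
open import Algebra.Module.Bundles using (Module)
open import Algebra.Module.Morphism.Structures using (module ModuleMorphisms)
open ModuleMorphisms using (module IsModuleHomomorphism)
import Algebra.Properties.Group as GroupProperties
import Algebra.Properties.AbelianGroup as AbelianGroupProperties
open import Axiom.UniquenessOfIdentityProofs using (module Decidable⇒UIP)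
open import Data.Empty using (⊥; ⊥-elim)
open import Data.Integer as ℤ using (ℤ; _<_; _+_; _-_; +_; -[1+_]; ∣_∣)
import Data.Integer.Properties as ℤP
open import Data.Integer.Solver using (module +-*-Solver)
open import Data.Nat as ℕ using (ℕ; zero; suc)
import Data.Nat.Properties as ℕP
open import Data.Product using (Σ; ∃; _×_; _,_; proj₁; proj₂)
open import Data.Sum using (_⊎_; inj₁; inj₂)
open import Relation.Binary.PropositionalEquality using (_≡_; refl; sym; trans; cong; cong₂; subst; module ≡-Reasoning)
import Relation.Binary.Reasoning.Setoid as SetoidReasoning

open import Algebra.Properties.AbelianGroup ℤP.+-0-abelianGroup using (∙-cancelˡ)
open +-*-Solver using (solve; _:+_; _:-_; :-_; _:=_; con)

-- Degree arithmetic

ℤ-≡-irrelevant : {a b : ℤ} (p q : a ≡ b) → p ≡ q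
ℤ-≡-irrelevant = Decidable⇒UIP.≡-irrelevant ℤP._≟_

+-pos-suc : ∀ i k → (i + + k) + + 1 ≡ i + + suc k
+-pos-suc i k = trans (ℤP.+-assoc i (+ k) (+ 1)) (cong (λ t → i + + t) (ℕP.+-comm k 1))

+-pos-+ : ∀ i a b → i + + (a ℕ.+ b) ≡ (i + + b) + + a
+-pos-+ i a b = solve 3 (λ I A B → I :+ (A :+ B) := (I :+ B) :+ A) refl i (+ a) (+ b)

+-cancelˡ-pos : ∀ a {x y : ℕ} → a + + x ≡ a + + y → x ≡ y
+-cancelˡ-pos a {x} {y} h = ℤP.+-injective (∙-cancelˡ a (+ x) (+ y) h)

<⇒+suc : ∀ {a b} → a < b → b ≡ a + + suc ∣ b - ℤ.suc a ∣
<⇒+suc {a} {b} a<b = trans (solve 2 (λ B A → B := A :+ (con (+ 1) :+ (B :- (con (+ 1) :+ A)))) refl b a)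
                           (cong (λ d → a + (+ 1 + d)) (sym ∣b-1-a∣≡b-1-a))
  where
    ∣b-1-a∣≡b-1-a : + ∣ b - ℤ.suc a ∣ ≡ b - ℤ.suc a
    ∣b-1-a∣≡b-1-a = ℤP.0≤i⇒+∣i∣≡i (ℤP.i≤j⇒0≤j-i (ℤP.i<j⇒suc[i]≤j a<b))

ind-from-below : ∀ {q} (N : ℕ) (Q : ℤ → Set q) → (∀ i → N ℕ.< ∣ i ∣ → Q i) →
                 (∀ i → Q (i - + 1) → Q i) → ∀ i → Q i
ind-from-below N Q base step i = go i (i + + suc N) refl
  where
    from-bottom : ∀ t → Q (-[1+ N ] + + t)
    from-bottom zero    = base _ (ℕP.n<1+n N)
    from-bottom (suc t) = step _ (subst Q bottom+t≡bottom+[1+t]-1 (from-bottom t))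
      where
        bottom+t≡bottom+[1+t]-1 : -[1+ N ] + + t ≡ (-[1+ N ] + + suc t) - + 1
        bottom+t≡bottom+[1+t]-1 = solve 2 (λ A T → A :+ T := (A :+ (con (+ 1) :+ T)) :- con (+ 1)) refl -[1+ N ] (+ t)
    split : ∀ i d → i + + suc N ≡ d → i ≡ -[1+ N ] + d
    split i d e = trans (solve 2 (λ I S → I := (:- S) :+ (I :+ S)) refl i (+ suc N)) (cong (λ d → -[1+ N ] + d) e)
    go : ∀ i d → i + + suc N ≡ d → Q i
    go i (+ t)    e = subst Q (sym (split i _ e)) (from-bottom t)
    go i -[1+ r ] e = base i (subst (λ z → N ℕ.< ∣ z ∣) (sym (split i _ e))
                                    (ℕ.s≤s (ℕP.≤-trans (ℕP.m≤m+n N r) (ℕP.n≤1+n _))))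

data Side (n i : ℤ) : Set where
  below : (k : ℕ) → (i + i) + + k ≡ n → Side n i
  above : (k : ℕ) → i + i ≡ n + + suc k → Side n i

side : ∀ n i → Side n i
side n i = go (n - (i + i)) refl
  where
    n≡2i+d : ∀ d → n - (i + i) ≡ d → n ≡ (i + i) + d
    n≡2i+d d e = trans (solve 2 (λ N I → N := (I :+ I) :+ (N :- (I :+ I))) refl n i) (cong (λ z → (i + i) + z) e)
    go : ∀ d → n - (i + i) ≡ d → Side n i
    go (+ k)    e = below k (sym (n≡2i+d _ e))
    go -[1+ k ] e = above k (trans (solve 2 (λ I S → I :+ I := ((I :+ I) :+ (:- S)) :+ S) refl i (+ suc k))
                                   (cong (_+ + suc k) (sym (n≡2i+d _ e))))

-- When i + i ≡ n + + suc k, mirror i k is n - i.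
mirror : ℤ → ℕ → ℤ
mirror i k = i - + suc k

mirror-+ : ∀ i k → mirror i k + + suc k ≡ i
mirror-+ i k = solve 2 (λ I S → (I :- S) :+ S := I) refl i (+ suc k)

mirror-below : ∀ {n} i k → i + i ≡ n + + suc k → (mirror i k + mirror i k) + + suc k ≡ n
mirror-below {n} i k e = begin
  (mirror i k + mirror i k) + + suc k ≡⟨ solve 2 (λ I S → ((I :- S) :+ (I :- S)) :+ S := (I :+ I) :- S) refl i (+ suc k) ⟩
  (i + i) - + suc k                   ≡⟨ cong (_- + suc k) e ⟩
  (n + + suc k) - + suc k             ≡⟨ solve 2 (λ N S → (N :+ S) :- S := N) refl n (+ suc k) ⟩
  n                                   ∎
  where open ≡-Reasoning

pred-+1 : ∀ i → (i - + 1) + + 1 ≡ i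
pred-+1 i = solve 1 (λ I → (I :- con (+ 1)) :+ con (+ 1) := I) refl i

pred-+ : ∀ i k → (i - + 1) + + suc (suc k) ≡ i + + suc k
pred-+ i k = solve 2 (λ I K → (I :- con (+ 1)) :+ (con (+ 2) :+ K) := I :+ (con (+ 1) :+ K)) refl i (+ k)

below-pred : ∀ {n} i k → (i + i) + + k ≡ n → ((i - + 1) + (i - + 1)) + + suc (suc k) ≡ n
below-pred {n} i k = trans
  (solve 2 (λ I K → ((I :- con (+ 1)) :+ (I :- con (+ 1))) :+ (con (+ 2) :+ K) := (I :+ I) :+ K) refl i (+ k))

below-widen : ∀ {n m} i k d → (i + i) + + k ≡ n → m ≡ n + + suc d → (i + i) + + (d ℕ.+ suc k) ≡ m
below-widen {n} {m} i k d e m≡n+1+d = begin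
  (i + i) + + (d ℕ.+ suc k) ≡⟨ solve 3 (λ I D K → (I :+ I) :+ (D :+ (con (+ 1) :+ K)) := ((I :+ I) :+ K) :+ (con (+ 1) :+ D))
                                       refl i (+ d) (+ k) ⟩
  ((i + i) + + k) + + suc d ≡⟨ cong (_+ + suc d) e ⟩
  n + + suc d               ≡⟨ m≡n+1+d ⟨
  m                         ∎
  where open ≡-Reasoning

suc+suc : ∀ i → (i + + 1) + (i + + 1) ≡ (i + i) + + 2
suc+suc i = solve 1 (λ I → (I :+ con (+ 1)) :+ (I :+ con (+ 1)) := (I :+ I) :+ con (+ 2)) refl i

below-suc-below : ∀ {n} i k k' → (i + i) + + k ≡ n → ((i + + 1) + (i + + 1)) + + k' ≡ n → k ≡ suc (suc k')
below-suc-below {n} i k k' e e' = +-cancelˡ-pos (i + i) (begin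
  (i + i) + + k                   ≡⟨ trans e (sym e') ⟩
  ((i + + 1) + (i + + 1)) + + k'  ≡⟨ cong (_+ + k') (suc+suc i) ⟩
  ((i + i) + + 2) + + k'          ≡⟨ ℤP.+-assoc (i + i) (+ 2) (+ k') ⟩
  (i + i) + + suc (suc k')        ∎)
  where open ≡-Reasoning

below-suc-above : ∀ {n} i k k' → (i + i) + + k ≡ n → (i + + 1) + (i + + 1) ≡ n + + suc k' →
                  (k ≡ 0 × k' ≡ 1) ⊎ (k ≡ 1 × k' ≡ 0)
below-suc-above {n} i k k' e e' = two k k' (+-cancelˡ-pos (i + i) (begin
  (i + i) + + (k ℕ.+ suc k') ≡⟨ sym (ℤP.+-assoc (i + i) (+ k) (+ suc k')) ⟩
  ((i + i) + + k) + + suc k' ≡⟨ cong (_+ + suc k') e ⟩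
  n + + suc k'               ≡⟨ sym e' ⟩
  (i + + 1) + (i + + 1)      ≡⟨ suc+suc i ⟩
  (i + i) + + 2              ∎))
  where
    open ≡-Reasoning
    two : ∀ k k' → k ℕ.+ suc k' ≡ 2 → (k ≡ 0 × k' ≡ 1) ⊎ (k ≡ 1 × k' ≡ 0)
    two zero          (suc zero) refl = inj₁ (refl , refl)
    two (suc zero)    zero       refl = inj₂ (refl , refl)
    two zero          zero       ()
    two zero          (suc (suc k')) ()
    two (suc zero)    (suc k')   ()
    two (suc (suc k)) k'         h with trans (sym (ℕP.+-suc k k')) (cong ℕ.pred (cong ℕ.pred h))
    ... | ()

above-suc-above : ∀ {n} i k k' → i + i ≡ n + + suc k → (i + + 1) + (i + + 1) ≡ n + + suc k' → k' ≡ suc (suc k)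
above-suc-above {n} i k k' e e' = cong ℕ.pred (+-cancelˡ-pos n (begin
  n + + suc k'            ≡⟨ sym e' ⟩
  (i + + 1) + (i + + 1)   ≡⟨ suc+suc i ⟩
  (i + i) + + 2           ≡⟨ cong (_+ + 2) e ⟩
  (n + + suc k) + + 2     ≡⟨ ℤP.+-assoc n (+ suc k) (+ 2) ⟩
  n + + (suc k ℕ.+ 2)     ≡⟨ cong (λ t → n + + t) (ℕP.+-comm (suc k) 2) ⟩
  n + + suc (suc (suc k)) ∎))
  where open ≡-Reasoning

above-suc-below : ∀ {n} i k k' → i + i ≡ n + + suc k → ((i + + 1) + (i + + 1)) + + k' ≡ n → ⊥
above-suc-below {n} i k k' e e' with +-cancelˡ-pos n {suc k ℕ.+ suc (suc k')} {0} (begin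
  n + + (suc k ℕ.+ suc (suc k')) ≡⟨ sym (ℤP.+-assoc n (+ suc k) (+ suc (suc k'))) ⟩
  (n + + suc k) + + suc (suc k') ≡⟨ cong (_+ + suc (suc k')) (sym e) ⟩
  (i + i) + + suc (suc k')       ≡⟨ sym (ℤP.+-assoc (i + i) (+ 2) (+ k')) ⟩
  ((i + i) + + 2) + + k'         ≡⟨ cong (_+ + k') (sym (suc+suc i)) ⟩
  ((i + + 1) + (i + + 1)) + + k' ≡⟨ trans e' (sym (ℤP.+-identityʳ n)) ⟩
  n + + 0                        ∎)
  where open ≡-Reasoning
... | ()

-- Graded objects and powers of 𝖫

module Graded {c ℓ m ℓm : Level} {E : CommutativeRing c ℓ} (A : Obj E m ℓm) where
  open Obj A public using (V; L; L-linear; Elt; Lpow)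

  open module Vᵢ {i : ℤ} = Module (V i) public
    using (_≈ᴹ_; _+ᴹ_; -ᴹ_; 0ᴹ; _*ₗ_; ≈ᴹ-refl; ≈ᴹ-sym; ≈ᴹ-trans; ≈ᴹ-reflexive;
           +ᴹ-cong; +ᴹ-congˡ; +ᴹ-congʳ; +ᴹ-assoc; +ᴹ-comm; +ᴹ-identityˡ; +ᴹ-identityʳ;
           -ᴹ‿cong; -ᴹ‿inverseʳ; *ₗ-congˡ; *ₗ-zeroʳ)
  private
    open module Gᵢ {i : ℤ} = GroupProperties (Module.+ᴹ-group (V i))
      using (x∙y⁻¹≈ε⇒x≈y; x≈y⇒x∙y⁻¹≈ε; ε⁻¹≈ε; //-rightDividesˡ; //-cong₂)
    open module Aᵢ {i : ℤ} = AbelianGroupProperties (Module.+ᴹ-abelianGroup (V i))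
      using (⁻¹-anti-homo‿-)

  module ≈-Reasoning (i : ℤ) = SetoidReasoning (Module.≈ᴹ-setoid (V i))
  module L-linear (i : ℤ) = IsModuleHomomorphism (L-linear i)

  infixl 6 _-ᴹ_
  _-ᴹ_ : ∀ {i} → Elt i → Elt i → Elt i
  x -ᴹ y = x +ᴹ -ᴹ y

  -ᴹ-cong : ∀ {i} {x x' y y' : Elt i} → x ≈ᴹ x' → y ≈ᴹ y' → x -ᴹ y ≈ᴹ x' -ᴹ y'
  -ᴹ-cong = //-cong₂

  x-ᴹy≈0⇒x≈y : ∀ {i} {x y : Elt i} → x -ᴹ y ≈ᴹ 0ᴹ → x ≈ᴹ y
  x-ᴹy≈0⇒x≈y = x∙y⁻¹≈ε⇒x≈y _ _

  x≈y⇒x-ᴹy≈0 : ∀ {i} {x y : Elt i} → x ≈ᴹ y → x -ᴹ y ≈ᴹ 0ᴹ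
  x≈y⇒x-ᴹy≈0 = x≈y⇒x∙y⁻¹≈ε

  [x-ᴹz]+ᴹz≈x : ∀ {i} (x z : Elt i) → (x -ᴹ z) +ᴹ z ≈ᴹ x
  [x-ᴹz]+ᴹz≈x x z = //-rightDividesˡ z x

  x-ᴹ[x-ᴹz]≈z : ∀ {i} (x z : Elt i) → x -ᴹ (x -ᴹ z) ≈ᴹ z
  x-ᴹ[x-ᴹz]≈z {i} x z = begin
    x +ᴹ -ᴹ (x +ᴹ -ᴹ z) ≈⟨ +ᴹ-congˡ (⁻¹-anti-homo‿- x z) ⟩
    x +ᴹ (z +ᴹ -ᴹ x)    ≈⟨ +ᴹ-congˡ (+ᴹ-comm z (-ᴹ x)) ⟩
    x +ᴹ (-ᴹ x +ᴹ z)    ≈⟨ +ᴹ-assoc x (-ᴹ x) z ⟨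
    (x +ᴹ -ᴹ x) +ᴹ z    ≈⟨ +ᴹ-congʳ (-ᴹ‿inverseʳ x) ⟩
    0ᴹ +ᴹ z             ≈⟨ +ᴹ-identityˡ z ⟩
    z                   ∎
    where open ≈-Reasoning i

  +ᴹ-≈0 : ∀ {i} {x y : Elt i} → x ≈ᴹ 0ᴹ → y ≈ᴹ 0ᴹ → x +ᴹ y ≈ᴹ 0ᴹ
  +ᴹ-≈0 x≈0 y≈0 = ≈ᴹ-trans (+ᴹ-cong x≈0 y≈0) (+ᴹ-identityˡ 0ᴹ)

  -ᴹ‿≈0 : ∀ {i} {x : Elt i} → x ≈ᴹ 0ᴹ → -ᴹ x ≈ᴹ 0ᴹ
  -ᴹ‿≈0 x≈0 = ≈ᴹ-trans (-ᴹ‿cong x≈0) ε⁻¹≈ε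

  y≈0⇒x-ᴹy≈x : ∀ {i} (x : Elt i) {y} → y ≈ᴹ 0ᴹ → x -ᴹ y ≈ᴹ x
  y≈0⇒x-ᴹy≈x x y≈0 = ≈ᴹ-trans (+ᴹ-congˡ (-ᴹ‿≈0 y≈0)) (+ᴹ-identityʳ x)

  cast : ∀ {i j} → i ≡ j → Elt i → Elt j
  cast = subst Elt

  cast-irrelevant : ∀ {i j} (p q : i ≡ j) x → cast p x ≡ cast q x
  cast-irrelevant p q x = cong (λ e → cast e x) (ℤ-≡-irrelevant p q)

  cast-cong : ∀ {i j} (p : i ≡ j) {x y} → x ≈ᴹ y → cast p x ≈ᴹ cast p y
  cast-cong refl x≈y = x≈y

  cast-+ᴹ : ∀ {i j} (p : i ≡ j) x y → cast p (x +ᴹ y) ≡ cast p x +ᴹ cast p y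
  cast-+ᴹ refl x y = refl

  cast-neg : ∀ {i j} (p : i ≡ j) x → cast p (-ᴹ x) ≡ -ᴹ cast p x
  cast-neg refl x = refl

  cast-0ᴹ : ∀ {i j} (p : i ≡ j) → cast p 0ᴹ ≡ 0ᴹ
  cast-0ᴹ refl = refl

  cast-*ₗ : ∀ {i j} (p : i ≡ j) r x → cast p (r *ₗ x) ≡ r *ₗ cast p x
  cast-*ₗ refl r x = refl

  -- 𝖫ᵏ : V^i → V^j, with the target degree j separate from the proof of i + k ≡ j, so that
  -- degrees that are only propositionally equal can be matched without rewriting.
  L^ : ∀ k i j → i + + k ≡ j → Elt i → Elt j
  L^ zero    i j p x = cast (trans (sym (ℤP.+-identityʳ i)) p) x
  L^ (suc k) i j p x = cast (trans (+-pos-suc i k) p) (L (i + + k) (L^ k i (i + + k) refl x))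

  L^-irrelevant : ∀ k i j (p q : i + + k ≡ j) x → L^ k i j p x ≡ L^ k i j q x
  L^-irrelevant k i j p q x = cong (λ e → L^ k i j e x) (ℤ-≡-irrelevant p q)

  Lpow≡L^ : ∀ k i x → Lpow k i x ≡ L^ k i (i + + k) refl x
  Lpow≡L^ zero    i x = cast-irrelevant _ _ x
  Lpow≡L^ (suc k) i x = cong₂ (λ e y → cast e (L (i + + k) y)) (ℤ-≡-irrelevant _ _) (Lpow≡L^ k i x)

  cast-L^ : ∀ k i j l (p : i + + k ≡ j) (e : j ≡ l) (r : i + + k ≡ l) x → cast e (L^ k i j p x) ≡ L^ k i l r x
  cast-L^ k i j l p refl r x = L^-irrelevant k i j p r x

  L^-cast : ∀ k i i' j (e : i ≡ i') (p : i' + + k ≡ j) (p' : i + + k ≡ j) x → L^ k i' j p (cast e x) ≡ L^ k i j p' x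
  L^-cast k i .i j refl p p' x = L^-irrelevant k i j p p' x

  L^-suc : ∀ k i j l (p : i + + k ≡ j) (q : j + + 1 ≡ l) (r : i + + suc k ≡ l) x →
           L^ (suc k) i l r x ≡ cast q (L j (L^ k i j p x))
  L^-suc k i j l refl q r x = cast-irrelevant (trans (+-pos-suc i k) r) q _

  L^-one : ∀ i j (p : i + + 1 ≡ j) x → L^ 1 i j p x ≡ cast p (L i x)
  L^-one i j p x = trans (L^-suc 0 i i j (ℤP.+-identityʳ i) p p x)
                         (cong (λ y → cast p (L i y)) (cast-irrelevant _ refl x))

  L^-cong : ∀ k i j p {x y} → x ≈ᴹ y → L^ k i j p x ≈ᴹ L^ k i j p y
  L^-cong zero    i j p x≈y = cast-cong _ x≈y
  L^-cong (suc k) i j p x≈y = cast-cong _ (L-linear.⟦⟧-cong (i + + k) (L^-cong k i _ refl x≈y))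

  L^-+ᴹ : ∀ k i j p x y → L^ k i j p (x +ᴹ y) ≈ᴹ L^ k i j p x +ᴹ L^ k i j p y
  L^-+ᴹ zero    i j p x y = ≈ᴹ-reflexive (cast-+ᴹ _ x y)
  L^-+ᴹ (suc k) i j p x y = ≈ᴹ-trans
    (cast-cong _ (≈ᴹ-trans (L-linear.⟦⟧-cong (i + + k) (L^-+ᴹ k i _ refl x y)) (L-linear.+ᴹ-homo (i + + k) _ _)))
    (≈ᴹ-reflexive (cast-+ᴹ _ _ _))

  L^-neg : ∀ k i j p x → L^ k i j p (-ᴹ x) ≈ᴹ -ᴹ L^ k i j p x
  L^-neg zero    i j p x = ≈ᴹ-reflexive (cast-neg _ x)
  L^-neg (suc k) i j p x = ≈ᴹ-trans
    (cast-cong _ (≈ᴹ-trans (L-linear.⟦⟧-cong (i + + k) (L^-neg k i _ refl x)) (L-linear.-ᴹ-homo (i + + k) _)))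
    (≈ᴹ-reflexive (cast-neg _ _))

  L^-0ᴹ : ∀ k i j p → L^ k i j p 0ᴹ ≈ᴹ 0ᴹ
  L^-0ᴹ zero    i j p = ≈ᴹ-reflexive (cast-0ᴹ _)
  L^-0ᴹ (suc k) i j p = ≈ᴹ-trans
    (cast-cong _ (≈ᴹ-trans (L-linear.⟦⟧-cong (i + + k) (L^-0ᴹ k i _ refl)) (L-linear.0ᴹ-homo (i + + k))))
    (≈ᴹ-reflexive (cast-0ᴹ _))

  L^-*ₗ : ∀ k i j p r x → L^ k i j p (r *ₗ x) ≈ᴹ r *ₗ L^ k i j p x
  L^-*ₗ zero    i j p r x = ≈ᴹ-reflexive (cast-*ₗ _ r x)
  L^-*ₗ (suc k) i j p r x = ≈ᴹ-trans
    (cast-cong _ (≈ᴹ-trans (L-linear.⟦⟧-cong (i + + k) (L^-*ₗ k i _ refl r x)) (L-linear.*ₗ-homo (i + + k) r _)))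
    (≈ᴹ-reflexive (cast-*ₗ _ _ _))

  L^-sub : ∀ k i j p x y → L^ k i j p (x -ᴹ y) ≈ᴹ L^ k i j p x -ᴹ L^ k i j p y
  L^-sub k i j p x y = ≈ᴹ-trans (L^-+ᴹ k i j p x _) (+ᴹ-congˡ (L^-neg k i j p y))

  L^-≈0 : ∀ k i j p {x} → x ≈ᴹ 0ᴹ → L^ k i j p x ≈ᴹ 0ᴹ
  L^-≈0 k i j p x≈0 = ≈ᴹ-trans (L^-cong k i j p x≈0) (L^-0ᴹ k i j p)

  L^-∘ : ∀ a b c → a ℕ.+ b ≡ c → ∀ i j l (p : i + + b ≡ j) (q : j + + a ≡ l) (r : i + + c ≡ l) x →
         L^ a j l q (L^ b i j p x) ≈ᴹ L^ c i l r x
  L^-∘ a b .(a ℕ.+ b) refl = go a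
    where
      go : ∀ a i j l (p : i + + b ≡ j) (q : j + + a ≡ l) (r : i + + (a ℕ.+ b) ≡ l) x →
           L^ a j l q (L^ b i j p x) ≈ᴹ L^ (a ℕ.+ b) i l r x
      go zero    i j l p q r x = ≈ᴹ-reflexive (cast-L^ b i j l p _ r x)
      go (suc a) i .(i + + b) l refl q r x = ≈ᴹ-trans
        (cast-cong _ (L-linear.⟦⟧-cong ((i + + b) + + a) (go a i (i + + b) _ refl refl (+-pos-+ i a b) x)))
        (≈ᴹ-reflexive (sym (L^-suc (a ℕ.+ b) i _ l (+-pos-+ i a b) _ r x)))

  L^-L : ∀ k i j (p : (i + + 1) + + k ≡ j) (r : i + + suc k ≡ j) x → L^ k (i + + 1) j p (L i x) ≈ᴹ L^ (suc k) i j r x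
  L^-L k i j p r x = ≈ᴹ-trans (L^-cong k (i + + 1) j p (≈ᴹ-reflexive (sym (L^-one i (i + + 1) refl x))))
                              (L^-∘ k 1 (suc k) (ℕP.+-comm k 1) i (i + + 1) j refl p r x)

  record NaturalEndo : Set (c ⊔ m ⊔ ℓm) where
    field
      op      : ∀ {i} → Elt i → Elt i
      op-cong : ∀ {i} {x y : Elt i} → x ≈ᴹ y → op x ≈ᴹ op y
      op-0ᴹ   : ∀ {i} → op {i} 0ᴹ ≈ᴹ 0ᴹ
      op-L^   : ∀ k i j p x → L^ k i j p (op x) ≈ᴹ op (L^ k i j p x)

  negation : NaturalEndo
  negation = record { op = -ᴹ_ ; op-cong = -ᴹ‿cong ; op-0ᴹ = -ᴹ‿≈0 ≈ᴹ-refl ; op-L^ = L^-neg }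

  scaling : CommutativeRing.Carrier E → NaturalEndo
  scaling r = record { op = r *ₗ_ ; op-cong = *ₗ-congˡ ; op-0ᴹ = *ₗ-zeroʳ r ; op-L^ = λ k i j p → L^-*ₗ k i j p r }

  module _ {n} (lefschetz : IsLefschetz E A n) where

    lefschetz-injective : ∀ i k → (i + i) + + k ≡ n → ∀ j (p : i + + k ≡ j) {x y} →
                          L^ k i j p x ≈ᴹ L^ k i j p y → x ≈ᴹ y
    lefschetz-injective i k e .(i + + k) refl {x} {y} h =
      proj₁ (lefschetz i k e)
        (≈ᴹ-trans (≈ᴹ-reflexive (Lpow≡L^ k i x)) (≈ᴹ-trans h (≈ᴹ-reflexive (sym (Lpow≡L^ k i y)))))

    lefschetz-surjective : ∀ i k → (i + i) + + k ≡ n → ∀ j (p : i + + k ≡ j) y → ∃ λ x → L^ k i j p x ≈ᴹ y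
    lefschetz-surjective i k e .(i + + k) refl y with proj₂ (lefschetz i k e) y
    ... | x , h = x , ≈ᴹ-trans (≈ᴹ-reflexive (sym (Lpow≡L^ k i x))) (h ≈ᴹ-refl)

    lefschetz-≈0 : ∀ i k → (i + i) + + k ≡ n → ∀ j (p : i + + k ≡ j) {x} → L^ k i j p x ≈ᴹ 0ᴹ → x ≈ᴹ 0ᴹ
    lefschetz-≈0 i k e j p h = lefschetz-injective i k e j p (≈ᴹ-trans h (≈ᴹ-sym (L^-0ᴹ k i j p)))

    lefschetz-decomposition : ∀ i k → (i + i) + + k ≡ n → ∀ x →
      ∃ λ z → L^ (suc k) i (i + + suc k) refl (x -ᴹ L^ 1 (i - + 1) i (pred-+1 i) z) ≈ᴹ 0ᴹ
    lefschetz-decomposition i k e x = z , (begin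
      L^ (suc k) i j refl (x -ᴹ Lz)                   ≈⟨ L^-sub (suc k) i j refl x Lz ⟩
      L^ (suc k) i j refl x -ᴹ L^ (suc k) i j refl Lz ≈⟨ -ᴹ-cong ≈ᴹ-refl L^Lz≈L^x ⟩
      L^ (suc k) i j refl x -ᴹ L^ (suc k) i j refl x  ≈⟨ x≈y⇒x-ᴹy≈0 ≈ᴹ-refl ⟩
      0ᴹ                                              ∎)
      where
        open ≈-Reasoning (i + + suc k)
        j = i + + suc k
        z,L^z≈L^x = lefschetz-surjective (i - + 1) (suc (suc k)) (below-pred i k e) j (pred-+ i k)
                                         (L^ (suc k) i j refl x)
        z = proj₁ z,L^z≈L^x
        Lz = L^ 1 (i - + 1) i (pred-+1 i) z
        L^Lz≈L^x : L^ (suc k) i j refl Lz ≈ᴹ L^ (suc k) i j refl x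
        L^Lz≈L^x = ≈ᴹ-trans
          (L^-∘ (suc k) 1 (suc (suc k)) (ℕP.+-comm (suc k) 1) (i - + 1) i j (pred-+1 i) refl (pred-+ i k) z)
          (proj₂ z,L^z≈L^x)

module HomPowers {c ℓ m₁ ℓ₁ m₂ ℓ₂ : Level} {E : CommutativeRing c ℓ} {A : Obj E m₁ ℓ₁} {B : Obj E m₂ ℓ₂}
  (φ : Hom E A B) where
  private
    module A = Graded A
    module B = Graded B
  open Hom φ public using (f; f-L)
  module f-linear (i : ℤ) = IsModuleHomomorphism (Hom.f-linear φ i)

  f-cast : ∀ {i j} (e : i ≡ j) x → f j (A.cast e x) ≡ B.cast e (f i x)
  f-cast refl x = refl

  f-L^ : ∀ k i j p x → f j (A.L^ k i j p x) B.≈ᴹ B.L^ k i j p (f i x)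
  f-L^ zero    i j p x = B.≈ᴹ-reflexive (f-cast _ x)
  f-L^ (suc k) i j p x = B.≈ᴹ-trans (B.≈ᴹ-reflexive (f-cast _ _))
    (B.cast-cong _ (B.≈ᴹ-trans (f-L (i + + k) _) (B.L-linear.⟦⟧-cong (i + + k) (f-L^ k i (i + + k) refl x))))

  f-≈0 : ∀ {i} {x} → x A.≈ᴹ A.0ᴹ → f i x B.≈ᴹ B.0ᴹ
  f-≈0 {i} x≈0 = B.≈ᴹ-trans (f-linear.⟦⟧-cong i x≈0) (f-linear.0ᴹ-homo i)

  f-sub : ∀ i x y → f i (x A.-ᴹ y) B.≈ᴹ f i x B.-ᴹ f i y
  f-sub i x y = B.≈ᴹ-trans (f-linear.+ᴹ-homo i x _) (B.+ᴹ-congˡ (f-linear.-ᴹ-homo i y))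

-- Morphisms between Lefschetz modules

module _ {c ℓ m₁ ℓ₁ m₂ ℓ₂ : Level} {E : CommutativeRing c ℓ}
  {A : Obj E m₁ ℓ₁} {B : Obj E m₂ ℓ₂} {n m : ℤ}
  (lefA : IsLefschetz E A n) (lefB : IsLefschetz E B m) (n<m : n < m) (φ : Hom E A B) where
  private
    module A = Graded A
    module B = Graded B
    open HomPowers φ
    d = ∣ m - ℤ.suc n ∣

  f-primitive≈0 : ∀ i k → (i + i) + + k ≡ n →
                  ∀ x → A.L^ (suc k) i (i + + suc k) refl x A.≈ᴹ A.0ᴹ → f i x B.≈ᴹ B.0ᴹ
  f-primitive≈0 i k e x L^x≈0 =
    B.lefschetz-≈0 lefB i (d ℕ.+ suc k) (below-widen i k d e (<⇒+suc n<m)) _ (+-pos-+ i d (suc k)) (begin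
      B.L^ (d ℕ.+ suc k) i _ _ (f i x)                ≈⟨ B.L^-∘ d (suc k) _ refl i j _ refl refl _ (f i x) ⟨
      B.L^ d j _ refl (B.L^ (suc k) i j refl (f i x)) ≈⟨ B.L^-cong d j _ refl (f-L^ (suc k) i j refl x) ⟨
      B.L^ d j _ refl (f j (A.L^ (suc k) i j refl x)) ≈⟨ B.L^-≈0 d j _ refl (f-≈0 L^x≈0) ⟩
      B.0ᴹ                                            ∎)
    where
      open B.≈-Reasoning ((i + + suc k) + + d)
      j = i + + suc k

  f≈0-below : ∀ i k → (i + i) + + k ≡ n → ∀ x → f i x B.≈ᴹ B.0ᴹ
  f≈0-below = ind-from-below (proj₁ (Obj.bounded A)) Vanishes
    (λ i N<∣i∣ k e x → f-≈0 (proj₂ (Obj.bounded A) i N<∣i∣ x)) step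
    where
      Vanishes : ℤ → Set _
      Vanishes i = ∀ k → (i + i) + + k ≡ n → ∀ x → f i x B.≈ᴹ B.0ᴹ
      step : ∀ i → Vanishes (i - + 1) → Vanishes i
      step i IH k e x = begin
        f i x                       ≈⟨ f-linear.⟦⟧-cong i (A.[x-ᴹz]+ᴹz≈x x Lz) ⟨
        f i ((x A.-ᴹ Lz) A.+ᴹ Lz)   ≈⟨ f-linear.+ᴹ-homo i _ Lz ⟩
        f i (x A.-ᴹ Lz) B.+ᴹ f i Lz ≈⟨ B.+ᴹ-≈0 (f-primitive≈0 i k e _ (proj₂ decomposition)) f[Lz]≈0 ⟩
        B.0ᴹ                        ∎
        where
          open B.≈-Reasoning i
          decomposition = A.lefschetz-decomposition lefA i k e x
          Lz = A.L^ 1 (i - + 1) i (pred-+1 i) (proj₁ decomposition)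
          f[Lz]≈0 : f i Lz B.≈ᴹ B.0ᴹ
          f[Lz]≈0 = B.≈ᴹ-trans (f-L^ 1 (i - + 1) i (pred-+1 i) _)
                               (B.L^-≈0 1 (i - + 1) i (pred-+1 i) (IH (suc (suc k)) (below-pred i k e) _))

  lefschetz-hom-vanishes : IsZeroHom E φ
  lefschetz-hom-vanishes i x with side n i
  ... | below k e = f≈0-below i k e x
  ... | above k e = begin
    f i x                                 ≈⟨ f-linear.⟦⟧-cong i (proj₂ w,L^w≈x) ⟨
    f i (A.L^ (suc k) (mirror i k) i _ w) ≈⟨ f-L^ (suc k) (mirror i k) i (mirror-+ i k) w ⟩
    B.L^ (suc k) (mirror i k) i _ (f _ w) ≈⟨ B.L^-≈0 (suc k) (mirror i k) i _ (f≈0-below _ (suc k) (mirror-below i k e) w) ⟩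
    B.0ᴹ                                  ∎
    where
      open B.≈-Reasoning i
      w,L^w≈x = A.lefschetz-surjective lefA (mirror i k) (suc k) (mirror-below i k e) i (mirror-+ i k) x
      w = proj₁ w,L^w≈x

-- Splittings of short exact sequences

record SplittingSubobject {c ℓ m₁ ℓ₁ m₂ ℓ₂ : Level} {E : CommutativeRing c ℓ}
  {X : Obj E m₁ ℓ₁} {W : Obj E m₂ ℓ₂} (π : Hom E X W) (ℓy : Level)
  : Set (c ⊔ ℓ ⊔ m₁ ⊔ ℓ₁ ⊔ m₂ ⊔ ℓ₂ ⊔ Level.suc ℓy) where
  private
    module X = Graded X
    module W = Graded W
    open HomPowers π using (f)
  field
    Y          : ∀ i → X.Elt i → Set ℓy
    Y-resp     : ∀ {i} {y y'} → y X.≈ᴹ y' → Y i y → Y i y'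
    Y-0ᴹ       : ∀ {i} → Y i X.0ᴹ
    Y-+ᴹ       : ∀ {i} {y y'} → Y i y → Y i y' → Y i (y X.+ᴹ y')
    Y-neg      : ∀ {i} {y} → Y i y → Y i (X.-ᴹ y)
    Y-*ₗ       : ∀ {i} r {y} → Y i y → Y i (r X.*ₗ y)
    Y-L        : ∀ {i} {y} → Y i y → Y (i + + 1) (X.L i y)
    π-kernel   : ∀ {i} {y} → Y i y → f i y W.≈ᴹ W.0ᴹ → y X.≈ᴹ X.0ᴹ
    π-lift     : ∀ i w → Σ (X.Elt i) λ y → Y i y × f i y W.≈ᴹ w

module _ {c ℓ m₁ ℓ₁ m₂ ℓ₂ ℓy : Level} {E : CommutativeRing c ℓ}
  {X : Obj E m₁ ℓ₁} {W : Obj E m₂ ℓ₂} {π : Hom E X W} (S : SplittingSubobject π ℓy) where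
  private
    module X = Graded X
    module W = Graded W
    open HomPowers π
    open SplittingSubobject S

  section : ∀ i → W.Elt i → X.Elt i
  section i w = proj₁ (π-lift i w)

  section-∈ : ∀ i w → Y i (section i w)
  section-∈ i w = proj₁ (proj₂ (π-lift i w))

  section-splits : ∀ i w → f i (section i w) W.≈ᴹ w
  section-splits i w = proj₂ (proj₂ (π-lift i w))

  section-unique : ∀ i w {y} → Y i y → f i y W.≈ᴹ w → section i w X.≈ᴹ y
  section-unique i w {y} y∈Y πy≈w = X.x-ᴹy≈0⇒x≈y (π-kernel (Y-+ᴹ (section-∈ i w) (Y-neg y∈Y)) (begin
    f i (section i w X.-ᴹ y)     ≈⟨ f-sub i (section i w) y ⟩
    f i (section i w) W.-ᴹ f i y ≈⟨ W.-ᴹ-cong (section-splits i w) πy≈w ⟩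
    w W.-ᴹ w                     ≈⟨ W.x≈y⇒x-ᴹy≈0 W.≈ᴹ-refl ⟩
    W.0ᴹ                         ∎))
    where open W.≈-Reasoning i

  section-linear : ∀ i → IsLinear E (W.V i) (X.V i) (section i)
  section-linear i = record
    { isBimoduleHomomorphism = record
      { +ᴹ-isGroupHomomorphism = record
        { isMonoidHomomorphism = record
          { isMagmaHomomorphism = record
            { isRelHomomorphism = record
              { cong = λ {w} {w'} w≈w' →
                  X.≈ᴹ-sym (section-unique i w' (section-∈ i w) (W.≈ᴹ-trans (section-splits i w) w≈w')) }
            ; homo = λ w w' → section-unique i _ (Y-+ᴹ (section-∈ i w) (section-∈ i w'))
                       (W.≈ᴹ-trans (f-linear.+ᴹ-homo i _ _) (W.+ᴹ-cong (section-splits i w) (section-splits i w')))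
            }
          ; ε-homo = section-unique i _ Y-0ᴹ (f-linear.0ᴹ-homo i)
          }
        ; ⁻¹-homo = λ w → section-unique i _ (Y-neg (section-∈ i w))
                       (W.≈ᴹ-trans (f-linear.-ᴹ-homo i _) (W.-ᴹ‿cong (section-splits i w)))
        }
      ; *ₗ-homo = λ r w → section-unique i _ (Y-*ₗ r (section-∈ i w))
                       (W.≈ᴹ-trans (f-linear.*ₗ-homo i r _) (W.*ₗ-congˡ (section-splits i w)))
      ; *ᵣ-homo = λ r w → section-unique i _
                       (Y-resp (Module.*ₗ-*ᵣ-coincident (X.V i) r (section i w)) (Y-*ₗ r (section-∈ i w)))
                       (W.≈ᴹ-trans (f-linear.*ᵣ-homo i r _)
                                   (Module.*ᵣ-cong (W.V i) (section-splits i w) (CommutativeRing.refl E)))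
      }
    }

  splitting : Hom E W X
  splitting = record
    { f        = section
    ; f-linear = section-linear
    ; f-L      = λ i w → section-unique (i + + 1) (W.L i w) (Y-L (section-∈ i w))
                   (W.≈ᴹ-trans (f-L i (section i w)) (W.L-linear.⟦⟧-cong i (section-splits i w)))
    }

module CanonicalComplement {c ℓ m ℓm : Level} {E : CommutativeRing c ℓ} {U W X : Obj E m ℓm} {n m' : ℤ}
  (lefU : IsLefschetz E U m') (lefW : IsLefschetz E W n) (m'≡n+1 : m' ≡ n + + 1)
  {ι : Hom E U X} {π : Hom E X W} (exact : IsShortExact E ι π) where

  open Graded X
  private
    module U = Graded U
    module W = Graded W
    module ι = HomPowers ι
    module π = HomPowers π
    open IsShortExact exact

  -- For 2i + k = n, Yᵗ t i k y says y ∈ Y^i, where Y^i = {y | 𝖫ᵏ⁺¹ y ∈ 𝖫ᵏ⁺² Y^(i-1)}, with the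
  -- recursion unfolded t degrees down to y ≈ 0; the depth t makes the recursion structural.
  Yᵗ : ℕ → (i : ℤ) → ℕ → Elt i → Set (m ⊔ ℓm)
  Yᵗ zero    i k y = Lift m (y ≈ᴹ 0ᴹ)
  Yᵗ (suc t) i k y = Σ (Elt (i - + 1)) λ y' → Yᵗ t (i - + 1) (suc (suc k)) y' ×
    L^ (suc k) i (i + + suc k) refl y ≈ᴹ L^ (suc (suc k)) (i - + 1) (i + + suc k) (pred-+ i k) y'

  Yᵗ-resp : ∀ t i k {y y'} → y ≈ᴹ y' → Yᵗ t i k y → Yᵗ t i k y'
  Yᵗ-resp zero    i k y≈y' (lift y≈0)    = lift (≈ᴹ-trans (≈ᴹ-sym y≈y') y≈0)
  Yᵗ-resp (suc t) i k y≈y' (y' , Y' , r) = y' , Y' , ≈ᴹ-trans (L^-cong (suc k) i _ refl (≈ᴹ-sym y≈y')) r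

  Yᵗ-suc : ∀ t i k {y} → Yᵗ t i k y → Yᵗ (suc t) i k y
  Yᵗ-suc zero    i k (lift y≈0)    = 0ᴹ , lift ≈ᴹ-refl ,
    ≈ᴹ-trans (L^-≈0 (suc k) i _ refl y≈0) (≈ᴹ-sym (L^-0ᴹ (suc (suc k)) (i - + 1) _ (pred-+ i k)))
  Yᵗ-suc (suc t) i k (y' , Y' , r) = y' , Yᵗ-suc t _ _ Y' , r

  Yᵗ-+ : ∀ s t i k {y} → Yᵗ t i k y → Yᵗ (s ℕ.+ t) i k y
  Yᵗ-+ zero    t i k Y = Y
  Yᵗ-+ (suc s) t i k Y = Yᵗ-suc (s ℕ.+ t) i k (Yᵗ-+ s t i k Y)

  Yᵗ-cast : ∀ t {i i'} k (e : i ≡ i') {y} → Yᵗ t i k y → Yᵗ t i' k (cast e y)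
  Yᵗ-cast t k refl Y = Y

  Yᵗ-+ᴹ : ∀ t i k {y₁ y₂} → Yᵗ t i k y₁ → Yᵗ t i k y₂ → Yᵗ t i k (y₁ +ᴹ y₂)
  Yᵗ-+ᴹ zero    i k (lift y₁≈0) (lift y₂≈0) = lift (+ᴹ-≈0 y₁≈0 y₂≈0)
  Yᵗ-+ᴹ (suc t) i k {y₁} {y₂} (y₁' , Y₁ , r₁) (y₂' , Y₂ , r₂) =
    y₁' +ᴹ y₂' , Yᵗ-+ᴹ t _ _ Y₁ Y₂ ,
    ≈ᴹ-trans (L^-+ᴹ (suc k) i _ refl y₁ y₂)
             (≈ᴹ-trans (+ᴹ-cong r₁ r₂) (≈ᴹ-sym (L^-+ᴹ (suc (suc k)) _ _ (pred-+ i k) y₁' y₂')))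

  Yᵗ-op : (O : NaturalEndo) → ∀ t i k {y} → Yᵗ t i k y → Yᵗ t i k (NaturalEndo.op O y)
  Yᵗ-op O zero    i k (lift y≈0)    = lift (≈ᴹ-trans (op-cong y≈0) op-0ᴹ)
    where open NaturalEndo O
  Yᵗ-op O (suc t) i k {y} (y' , Y' , r) = op y' , Yᵗ-op O t _ _ Y' ,
    ≈ᴹ-trans (op-L^ (suc k) i _ refl y) (≈ᴹ-trans (op-cong r) (≈ᴹ-sym (op-L^ (suc (suc k)) _ _ (pred-+ i k) y')))
    where open NaturalEndo O

  Yᵗ-kernel : ∀ t i k → (i + i) + + k ≡ n → ∀ {y} → Yᵗ t i k y → π.f i y W.≈ᴹ W.0ᴹ → y ≈ᴹ 0ᴹ
  Yᵗ-kernel zero    i k e (lift y≈0) πy≈0 = y≈0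
  Yᵗ-kernel (suc t) i k e {y} (y' , Y' , r) πy≈0 = begin
    y       ≈⟨ proj₂ u,ιu≈y ⟨
    ι.f i u ≈⟨ ι.f-≈0 u≈0 ⟩
    0ᴹ      ∎
    where
      open ≈-Reasoning i
      j = i + + suc k
      u,ιu≈y = ker⊆im i y πy≈0
      u = proj₁ u,ιu≈y
      L^πy'≈0 : W.L^ (suc (suc k)) (i - + 1) j (pred-+ i k) (π.f _ y') W.≈ᴹ W.0ᴹ
      L^πy'≈0 = W.≈ᴹ-trans (W.≈ᴹ-sym (π.f-L^ (suc (suc k)) (i - + 1) j (pred-+ i k) y'))
        (W.≈ᴹ-trans (π.f-linear.⟦⟧-cong j (≈ᴹ-sym r))
        (W.≈ᴹ-trans (π.f-L^ (suc k) i j refl y) (W.L^-≈0 (suc k) i j refl πy≈0)))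
      y'≈0 = Yᵗ-kernel t (i - + 1) (suc (suc k)) (below-pred i k e) Y'
               (W.lefschetz-≈0 lefW (i - + 1) (suc (suc k)) (below-pred i k e) j (pred-+ i k) L^πy'≈0)
      L^ιu≈0 : ι.f j (U.L^ (suc k) i j refl u) ≈ᴹ 0ᴹ
      L^ιu≈0 = ≈ᴹ-trans (ι.f-L^ (suc k) i j refl u) (≈ᴹ-trans (L^-cong (suc k) i j refl (proj₂ u,ιu≈y))
                 (≈ᴹ-trans r (L^-≈0 (suc (suc k)) (i - + 1) j (pred-+ i k) y'≈0)))
      u≈0 : u U.≈ᴹ U.0ᴹ
      u≈0 = U.lefschetz-≈0 lefU i (suc k) (below-widen i k 0 e m'≡n+1) j refl
              (ι-injective j (≈ᴹ-trans L^ιu≈0 (≈ᴹ-sym (ι.f-linear.0ᴹ-homo j))))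

  correct-lift : ∀ i k → (i + i) + + k ≡ n → ∀ x b →
                 π.f _ (L^ (suc k) i (i + + suc k) refl x) W.≈ᴹ π.f _ b →
                 ∃ λ u → L^ (suc k) i (i + + suc k) refl (x -ᴹ ι.f i u) ≈ᴹ b
  correct-lift i k e x b πL^x≈πb = u , (begin
    L^ (suc k) i j refl (x -ᴹ ι.f i u)                     ≈⟨ L^-sub (suc k) i j refl x (ι.f i u) ⟩
    L^ (suc k) i j refl x -ᴹ L^ (suc k) i j refl (ι.f i u) ≈⟨ -ᴹ-cong ≈ᴹ-refl L^ιu≈d ⟩
    L^ (suc k) i j refl x -ᴹ d                             ≈⟨ x-ᴹ[x-ᴹz]≈z _ b ⟩
    b                                                      ∎)
    where
      open ≈-Reasoning (i + + suc k)
      j = i + + suc k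
      d = L^ (suc k) i j refl x -ᴹ b
      v,ιv≈d = ker⊆im j d (W.≈ᴹ-trans (π.f-sub j _ b) (W.x≈y⇒x-ᴹy≈0 πL^x≈πb))
      u,L^u≈v = U.lefschetz-surjective lefU i (suc k) (below-widen i k 0 e m'≡n+1) j refl (proj₁ v,ιv≈d)
      u = proj₁ u,L^u≈v
      L^ιu≈d : L^ (suc k) i j refl (ι.f i u) ≈ᴹ d
      L^ιu≈d = ≈ᴹ-trans (≈ᴹ-sym (ι.f-L^ (suc k) i j refl u))
                 (≈ᴹ-trans (ι.f-linear.⟦⟧-cong j (proj₂ u,L^u≈v)) (proj₂ v,ιv≈d))

  Y≤ : (i : ℤ) → ℕ → Elt i → Set (m ⊔ ℓm)
  Y≤ i k y = Σ ℕ λ t → Yᵗ t i k y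

  Y≤-lift : ∀ i k → (i + i) + + k ≡ n → ∀ w → Σ (Elt i) λ y → Y≤ i k y × π.f i y W.≈ᴹ w
  Y≤-lift = ind-from-below (proj₁ (Obj.bounded W)) Liftable base step
    where
      Liftable : ℤ → Set _
      Liftable i = ∀ k → (i + i) + + k ≡ n → ∀ w → Σ (Elt i) λ y → Y≤ i k y × π.f i y W.≈ᴹ w
      base : ∀ i → proj₁ (Obj.bounded W) ℕ.< ∣ i ∣ → Liftable i
      base i N<∣i∣ k e w = 0ᴹ , (0 , lift ≈ᴹ-refl) ,
        W.≈ᴹ-trans (π.f-linear.0ᴹ-homo i) (W.≈ᴹ-sym (proj₂ (Obj.bounded W) i N<∣i∣ w))
      step : ∀ i → Liftable (i - + 1) → Liftable i
      step i IH k e w = x -ᴹ ι.f i u , (suc t , y' , Y' , proj₂ u,L^[x-ιu]≈L^y') , πy≈w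
        where
          j = i + + suc k
          w',L^w'≈L^w = W.lefschetz-surjective lefW (i - + 1) (suc (suc k)) (below-pred i k e) j (pred-+ i k)
                          (W.L^ (suc k) i j refl w)
          y',Y',πy'≈w' = IH (suc (suc k)) (below-pred i k e) (proj₁ w',L^w'≈L^w)
          y' = proj₁ y',Y',πy'≈w'
          t  = proj₁ (proj₁ (proj₂ y',Y',πy'≈w'))
          Y' = proj₂ (proj₁ (proj₂ y',Y',πy'≈w'))
          πy'≈w' = proj₂ (proj₂ y',Y',πy'≈w')
          x,πx≈w = π-surjective i w
          x = proj₁ x,πx≈w
          πx≈w : π.f i x W.≈ᴹ w
          πx≈w = proj₂ x,πx≈w ≈ᴹ-refl
          πL^x≈πL^y' : π.f j (L^ (suc k) i j refl x) W.≈ᴹ π.f j (L^ (suc (suc k)) (i - + 1) j (pred-+ i k) y')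
          πL^x≈πL^y' = begin
            π.f j (L^ (suc k) i j refl x)                          ≈⟨ π.f-L^ (suc k) i j refl x ⟩
            W.L^ (suc k) i j refl (π.f i x)                        ≈⟨ W.L^-cong (suc k) i j refl πx≈w ⟩
            W.L^ (suc k) i j refl w                                ≈⟨ proj₂ w',L^w'≈L^w ⟨
            W.L^ (suc (suc k)) (i - + 1) j (pred-+ i k) _          ≈⟨ W.L^-cong (suc (suc k)) (i - + 1) j (pred-+ i k) πy'≈w' ⟨
            W.L^ (suc (suc k)) (i - + 1) j (pred-+ i k) (π.f _ y') ≈⟨ π.f-L^ (suc (suc k)) (i - + 1) j (pred-+ i k) y' ⟨
            π.f j (L^ (suc (suc k)) (i - + 1) j (pred-+ i k) y')   ∎
            where open W.≈-Reasoning j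
          u,L^[x-ιu]≈L^y' = correct-lift i k e x _ πL^x≈πL^y'
          u = proj₁ u,L^[x-ιu]≈L^y'
          πy≈w : π.f i (x -ᴹ ι.f i u) W.≈ᴹ w
          πy≈w = W.≈ᴹ-trans (π.f-sub i x (ι.f i u)) (W.≈ᴹ-trans (W.y≈0⇒x-ᴹy≈x _ (im⊆ker i u)) πx≈w)

  Y≤-+ᴹ : ∀ i k {y₁ y₂} → Y≤ i k y₁ → Y≤ i k y₂ → Y≤ i k (y₁ +ᴹ y₂)
  Y≤-+ᴹ i k {y₁} {y₂} (t₁ , Y₁) (t₂ , Y₂) =
    t₂ ℕ.+ t₁ , Yᵗ-+ᴹ (t₂ ℕ.+ t₁) i k (Yᵗ-+ t₂ t₁ i k Y₁)
                  (subst (λ s → Yᵗ s i k y₂) (ℕP.+-comm t₁ t₂) (Yᵗ-+ t₁ t₂ i k Y₂))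

  Y> : (i : ℤ) → ℕ → Elt i → Set (m ⊔ ℓm)
  Y> i k y = Σ (Elt (mirror i k)) λ y' → Y≤ (mirror i k) (suc k) y' × L^ (suc k) (mirror i k) i (mirror-+ i k) y' ≈ᴹ y

  Y : ∀ i → Side n i → Elt i → Set (m ⊔ ℓm)
  Y i (below k _) y = Y≤ i k y
  Y i (above k _) y = Y> i k y

  Y-resp : ∀ i s {y y'} → y ≈ᴹ y' → Y i s y → Y i s y'
  Y-resp i (below k _) y≈y' (t , Y)        = t , Yᵗ-resp t i k y≈y' Y
  Y-resp i (above k _) y≈y' (y' , Y' , r)  = y' , Y' , ≈ᴹ-trans r y≈y'

  Y-0ᴹ : ∀ i s → Y i s 0ᴹ
  Y-0ᴹ i (below k _) = 0 , lift ≈ᴹ-refl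
  Y-0ᴹ i (above k _) = 0ᴹ , (0 , lift ≈ᴹ-refl) , L^-0ᴹ (suc k) (mirror i k) i (mirror-+ i k)

  Y-+ᴹ : ∀ i s {y₁ y₂} → Y i s y₁ → Y i s y₂ → Y i s (y₁ +ᴹ y₂)
  Y-+ᴹ i (below k _) Y₁ Y₂ = Y≤-+ᴹ i k Y₁ Y₂
  Y-+ᴹ i (above k _) (y₁' , Y₁ , r₁) (y₂' , Y₂ , r₂) =
    y₁' +ᴹ y₂' , Y≤-+ᴹ _ _ Y₁ Y₂ ,
    ≈ᴹ-trans (L^-+ᴹ (suc k) (mirror i k) i (mirror-+ i k) y₁' y₂') (+ᴹ-cong r₁ r₂)

  Y-op : (O : NaturalEndo) → ∀ i s {y} → Y i s y → Y i s (NaturalEndo.op O y)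
  Y-op O i (below k _) (t , Y) = t , Yᵗ-op O t i k Y
  Y-op O i (above k _) (y' , (t , Y') , r) = NaturalEndo.op O y' , (t , Yᵗ-op O t _ _ Y') ,
    ≈ᴹ-trans (NaturalEndo.op-L^ O (suc k) (mirror i k) i (mirror-+ i k) y') (NaturalEndo.op-cong O r)

  Y-kernel : ∀ i s {y} → Y i s y → π.f i y W.≈ᴹ W.0ᴹ → y ≈ᴹ 0ᴹ
  Y-kernel i (below k e) (t , Y) πy≈0 = Yᵗ-kernel t i k e Y πy≈0
  Y-kernel i (above k e) {y} (y' , (t , Y') , r) πy≈0 =
    ≈ᴹ-trans (≈ᴹ-sym r) (L^-≈0 (suc k) (mirror i k) i (mirror-+ i k) (Yᵗ-kernel t _ _ (mirror-below i k e) Y'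
      (W.lefschetz-≈0 lefW (mirror i k) (suc k) (mirror-below i k e) i (mirror-+ i k) L^πy'≈0)))
    where
      L^πy'≈0 : W.L^ (suc k) (mirror i k) i (mirror-+ i k) (π.f _ y') W.≈ᴹ W.0ᴹ
      L^πy'≈0 = W.≈ᴹ-trans (W.≈ᴹ-sym (π.f-L^ (suc k) (mirror i k) i (mirror-+ i k) y'))
                           (W.≈ᴹ-trans (π.f-linear.⟦⟧-cong i r) πy≈0)

  Y-lift : ∀ i s w → Σ (Elt i) λ y → Y i s y × π.f i y W.≈ᴹ w
  Y-lift i (below k e) w = Y≤-lift i k e w
  Y-lift i (above k e) w = L^ (suc k) (mirror i k) i (mirror-+ i k) y' , (y' , Y' , ≈ᴹ-refl) , (begin
    π.f i (L^ (suc k) (mirror i k) i (mirror-+ i k) y')   ≈⟨ π.f-L^ (suc k) (mirror i k) i (mirror-+ i k) y' ⟩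
    W.L^ (suc k) (mirror i k) i (mirror-+ i k) (π.f _ y') ≈⟨ W.L^-cong (suc k) (mirror i k) i (mirror-+ i k) πy'≈w' ⟩
    W.L^ (suc k) (mirror i k) i (mirror-+ i k) w'         ≈⟨ proj₂ w',L^w'≈w ⟩
    w                                                     ∎)
    where
      open W.≈-Reasoning i
      w',L^w'≈w = W.lefschetz-surjective lefW (mirror i k) (suc k) (mirror-below i k e) i (mirror-+ i k) w
      w' = proj₁ w',L^w'≈w
      y',Y',πy'≈w' = Y≤-lift (mirror i k) (suc k) (mirror-below i k e) w'
      y' = proj₁ y',Y',πy'≈w'
      Y' = proj₁ (proj₂ y',Y',πy'≈w')
      πy'≈w' = proj₂ (proj₂ y',Y',πy'≈w')

  Y≤-L : ∀ i k' {y} → Y≤ i (suc (suc k')) y → Y≤ (i + + 1) k' (L i y)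
  Y≤-L i k' {y} (t , Y) = suc t , cast i≡i+1-1 y , Yᵗ-cast t _ i≡i+1-1 Y , (begin
    L^ (suc k') (i + + 1) J refl (L i y) ≈⟨ L^-L (suc k') i J refl i+k'+2≡J y ⟩
    L^ (suc (suc k')) i J i+k'+2≡J y     ≡⟨ L^-cast (suc (suc k')) i _ J i≡i+1-1 _ i+k'+2≡J y ⟨
    L^ (suc (suc k')) ((i + + 1) - + 1) J (pred-+ (i + + 1) k') (cast i≡i+1-1 y) ∎)
    where
      open ≈-Reasoning ((i + + 1) + + suc k')
      J = (i + + 1) + + suc k'
      i≡i+1-1 : i ≡ (i + + 1) - + 1
      i≡i+1-1 = solve 1 (λ I → I := (I :+ con (+ 1)) :- con (+ 1)) refl i
      i+k'+2≡J : i + + suc (suc k') ≡ J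
      i+k'+2≡J = solve 2 (λ I K → I :+ (con (+ 2) :+ K) := (I :+ con (+ 1)) :+ (con (+ 1) :+ K)) refl i (+ k')

  Y≤-L-middle : ∀ i k k' → (k ≡ 0 × k' ≡ 1) ⊎ (k ≡ 1 × k' ≡ 0) → ∀ {y} → Y≤ i k y → Y> (i + + 1) k' (L i y)
  Y≤-L-middle i .0 .1 (inj₁ (refl , refl)) {y} (t , Y) with Yᵗ-suc t i 0 Y
  ... | y' , Y' , Ly≈L²y' = cast i-1≡i+1-2 y' , (t , Yᵗ-cast t _ i-1≡i+1-2 Y') , (begin
    L^ 2 (mirror (i + + 1) 1) (i + + 1) _ (cast i-1≡i+1-2 y') ≡⟨ L^-cast 2 (i - + 1) _ (i + + 1) i-1≡i+1-2 _ (pred-+ i 0) y' ⟩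
    L^ 2 (i - + 1) (i + + 1) (pred-+ i 0) y'                  ≈⟨ Ly≈L²y' ⟨
    L^ 1 i (i + + 1) refl y                                   ≡⟨ L^-one i (i + + 1) refl y ⟩
    L i y                                                     ∎)
    where
      open ≈-Reasoning (i + + 1)
      i-1≡i+1-2 : i - + 1 ≡ mirror (i + + 1) 1
      i-1≡i+1-2 = solve 1 (λ I → I :- con (+ 1) := (I :+ con (+ 1)) :- con (+ 2)) refl i
  Y≤-L-middle i .1 .0 (inj₂ (refl , refl)) {y} (t , Y) = cast i≡i+1-1 y , (t , Yᵗ-cast t _ i≡i+1-1 Y) , (begin
    L^ 1 (mirror (i + + 1) 0) (i + + 1) _ (cast i≡i+1-1 y) ≡⟨ L^-cast 1 i _ (i + + 1) i≡i+1-1 _ refl y ⟩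
    L^ 1 i (i + + 1) refl y                                ≡⟨ L^-one i (i + + 1) refl y ⟩
    L i y                                                  ∎)
    where
      open ≈-Reasoning (i + + 1)
      i≡i+1-1 : i ≡ mirror (i + + 1) 0
      i≡i+1-1 = solve 1 (λ I → I := (I :+ con (+ 1)) :- con (+ 1)) refl i

  Y>-L : ∀ i k {y} → Y> i k y → Y> (i + + 1) (suc (suc k)) (L i y)
  Y>-L i k {y} (y' , (t , Y') , L^y'≈y) with Yᵗ-suc t (mirror i k) (suc k) Y'
  ... | y'' , Y'' , L^y'≈L^y'' = cast j-1≡j' y'' , (t , Yᵗ-cast t _ j-1≡j' Y'') , (begin
    L^ (3 ℕ.+ k) j' (i + + 1) _ (cast j-1≡j' y'')
      ≡⟨ L^-cast (3 ℕ.+ k) (j - + 1) j' (i + + 1) j-1≡j' _ j-1+k+3≡i+1 y'' ⟩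
    L^ (3 ℕ.+ k) (j - + 1) (i + + 1) j-1+k+3≡i+1 y''
      ≡⟨ cast-L^ (3 ℕ.+ k) (j - + 1) J (i + + 1) (pred-+ j (suc k)) J≡i+1 _ y'' ⟨
    cast J≡i+1 (L^ (3 ℕ.+ k) (j - + 1) J (pred-+ j (suc k)) y'')
      ≈⟨ cast-cong J≡i+1 L^y'≈L^y'' ⟨
    cast J≡i+1 (L^ (2 ℕ.+ k) j J refl y')
      ≡⟨ cast-L^ (2 ℕ.+ k) j J (i + + 1) refl J≡i+1 J≡i+1 y' ⟩
    L^ (2 ℕ.+ k) j (i + + 1) J≡i+1 y'
      ≈⟨ L^-∘ 1 (suc k) (2 ℕ.+ k) refl j i (i + + 1) (mirror-+ i k) refl J≡i+1 y' ⟨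
    L^ 1 i (i + + 1) refl (L^ (suc k) j i (mirror-+ i k) y')
      ≡⟨ L^-one i (i + + 1) refl _ ⟩
    L i (L^ (suc k) j i (mirror-+ i k) y')
      ≈⟨ L-linear.⟦⟧-cong i L^y'≈y ⟩
    L i y
      ∎)
    where
      open ≈-Reasoning (i + + 1)
      j  = mirror i k
      j' = mirror (i + + 1) (suc (suc k))
      J  = j + + suc (suc k)
      j-1≡j' : j - + 1 ≡ j'
      j-1≡j' = solve 2 (λ I K → (I :- (con (+ 1) :+ K)) :- con (+ 1) := (I :+ con (+ 1)) :- (con (+ 3) :+ K)) refl i (+ k)
      J≡i+1 : J ≡ i + + 1
      J≡i+1 = solve 2 (λ I K → (I :- (con (+ 1) :+ K)) :+ (con (+ 2) :+ K) := I :+ con (+ 1)) refl i (+ k)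
      j-1+k+3≡i+1 : (j - + 1) + + (3 ℕ.+ k) ≡ i + + 1
      j-1+k+3≡i+1 = trans (pred-+ j (suc k)) J≡i+1

  Y-L : ∀ i s s' {y} → Y i s y → Y (i + + 1) s' (L i y)
  Y-L i (below k e) (below k' e') Y = subst (λ k → Y≤ i k _ → _) (sym (below-suc-below i k k' e e')) (Y≤-L i k') Y
  Y-L i (below k e) (above k' e') Y = Y≤-L-middle i k k' (below-suc-above {n} i k k' e e') Y
  Y-L i (above k e) (above k' e') Y =
    subst (λ k' → Y> (i + + 1) k' _) (sym (above-suc-above {n} i k k' e e')) (Y>-L i k Y)
  Y-L i (above k e) (below k' e') Y = ⊥-elim (above-suc-below {n} i k k' e e')

  canonical-complement : SplittingSubobject π (m ⊔ ℓm)
  canonical-complement = record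
    { Y        = λ i → Y i (side n i)
    ; Y-resp   = λ {i} → Y-resp i (side n i)
    ; Y-0ᴹ     = λ {i} → Y-0ᴹ i (side n i)
    ; Y-+ᴹ     = λ {i} → Y-+ᴹ i (side n i)
    ; Y-neg    = λ {i} → Y-op negation i (side n i)
    ; Y-*ₗ     = λ {i} r → Y-op (scaling r) i (side n i)
    ; Y-L      = λ {i} → Y-L i (side n i) (side n (i + + 1))
    ; π-kernel = λ {i} → Y-kernel i (side n i)
    ; π-lift   = λ i → Y-lift i (side n i)
    }

lefschetz-ext1-vanishes : ∀ {c ℓ m ℓm} {E : CommutativeRing c ℓ} {U W : Obj E m ℓm} {n m' : ℤ} →
  IsLefschetz E U m' → IsLefschetz E W n → m' ≡ n + + 1 → Ext1Vanishes E W U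
lefschetz-ext1-vanishes lefU lefW m'≡n+1 X ι π exact = splitting complement , section-splits complement
  where complement = CanonicalComplement.canonical-complement lefU lefW m'≡n+1 exact

proposition1p1p1 : ∀ {c ℓ m ℓm : Level} (E : CommutativeRing c ℓ) →
    IsField E → CharZero E →
    (U W : Obj E m ℓm) (mU nW : ℤ) →
    IsLefschetz E U mU → IsLefschetz E W nW →
    ((nW < mU → HomVanishes E W U) × (mU ≡ nW + + 1 → Ext1Vanishes E W U))
proposition1p1p1 E _ _ U W mU nW lefU lefW =
  (λ nW<mU → lefschetz-hom-vanishes lefW lefU nW<mU) , lefschetz-ext1-vanishes lefU lefW
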